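{- Let $\Psi$ be a function-free first-order sentence (possibly with cardinality constraints and ground unary literals) containing a binary predicate $R$ that is symmetric in every model of $\Psi$, let $n\in\mathbb{N}$ and $w,\overline{w}$ weighting functions. Then the extended weak connectedness polynomial satisfies $$f_n(u,v;\Psi,w,\overline{w},R)=\sum_{\mu\in\mathcal{M}_{\Psi,n}}W(\mu,w,\overline{w})\cdot(u+1)^{cc(\mu_R)}\,v^{2e(\mu_R)},$$ where $cc(\mu_R)$ is the number of connected components of $G(\mu_R)$ and $e(\mu_R)$ is the number of undirected edges of $G(\mu_R)$ (i.e., half the number of true ground atoms of $R$ in $\mu$).
   Context: A possible world over $[n]=\{1,\dots,n\}$ assigns truth values to all ground atoms of the predicates; $\mathcal{M}_{\Psi,n}$ is the set of worlds satisfying $\Psi$; $W(\mu,w,\overline{w})$ is the product of $w(P)$ over true ground atoms of $P$ and $\overline{w}(P)$ over false ones; $\mathrm{WFOMC}(\Psi,n,w,\overline{w})=\sum_{\mu\in\mathcal{M}_{\Psi,n}}W(\mu,w,\overline{w})$. $G(\mu_R)$ is the graph on $[n]$ with edge $a\to b$ iff $R(a,b)$ holds in $\mu$ (viewed as undirected when $R$ is symmetric). For positive integer $u$, $\Psi_{R,u}=\Psi\wedge\bigwedge_{i=1}^{u}\forall x\forall y\,(A_i(x)\wedge(R(x,y)\vee R(y,x))\to A_i(y))\wedge\bigwedge_{i=2}^{u}\forall x\,(A_i(x)\to A_{i-1}(x))$ with fresh unary $A_i$, $w(A_i)=\overline{w}(A_i)=1$. The extended weak connectedness polynomial $f_n(u,v;\Psi,w,\overline{w},R)$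 is the bivariate polynomial with $f_n(u,v;\Psi,w,\overline{w},R)=\mathrm{WFOMC}(\Psi_{R,u},n,w_{R,v},\overline{w})$ for all positive integers $u$ and real $v$, where $w_{R,v}(R)=v\cdot w(R)$ and $w_{R,v}(P)=w(P)$ for $P\neq R$. -}

module Defs where

open import Algebra.Bundles using (CommutativeRing)
open import Data.Nat using (ℕ; zero; suc; _^_; _≤ᵇ_; _≡ᵇ_)
open import Data.Fin using (Fin; zero; suc; inject₁; combine) renaming (_≟_ to _≟ᶠ_; _<?_ to _<?ᶠ_)
open import Data.Vec using (Vec; []; _∷_; lookup)
open import Data.List using (List; []; _∷_; foldr; map; concatMap; cartesianProduct; allFin)
open import Data.Bool.ListAction using (all; any)
open import Data.Bool using (Bool; true; false; _∧_; _∨_; not; if_then_else_)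
open import Data.Sum using (_⊎_; inj₁; inj₂)
open import Data.Product using (_×_; _,_)
open import Relation.Nullary.Decidable using (⌊_⌋)
open import Relation.Binary.PropositionalEquality using (_≡_; subst; sym)

data Sig : Set where
  preds : (k a : ℕ) → Sig
  _⊕_   : Sig → Sig → Sig

Pred : Sig → Set
Pred (preds k a) = Fin k
Pred (s ⊕ t)     = Pred s ⊎ Pred t

arity : (s : Sig) → Pred s → ℕ
arity (preds k a) _        = a
arity (s ⊕ t)     (inj₁ p) = arity s p
arity (s ⊕ t)     (inj₂ p) = arity t p

predEq : (s : Sig) → Pred s → Pred s → Bool
predEq (preds k a) p q               = ⌊ p ≟ᶠ q ⌋
predEq (s ⊕ t)     (inj₁ p) (inj₁ q) = predEq s p q
predEq (s ⊕ t)     (inj₂ p) (inj₂ q) = predEq t p q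
predEq (s ⊕ t)     _        _        = false

-- A predicate of arity a
-- is interpreted by its truth table: one Bool per ground tuple in
-- (Fin n)^a, tuples being indexed by Fin (n ^ a) via tupleIndex.

World : ℕ → Sig → Set
World n (preds k a) = Vec (Vec Bool (n ^ a)) k
World n (s ⊕ t)     = World n s × World n t

table : ∀ {n} (s : Sig) → World n s → (p : Pred s) → Vec Bool (n ^ arity s p)
table (preds k a) μ        p        = lookup μ p
table (s ⊕ t)     (μ , ν)  (inj₁ p) = table s μ p
table (s ⊕ t)     (μ , ν)  (inj₂ p) = table t ν p

tupleIndex : ∀ {n a} → Vec (Fin n) a → Fin (n ^ a)
tupleIndex []       = zero
tupleIndex (x ∷ xs) = combine x (tupleIndex xs)

holds : ∀ {n} (s : Sig) → World n s → (p : Pred s) → Vec (Fin n) (arity s p) → Bool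
holds s μ p ts = lookup (table s μ p) (tupleIndex ts)

allVecs : ∀ {A : Set} → List A → (k : ℕ) → List (Vec A k)
allVecs xs zero    = [] ∷ []
allVecs xs (suc k) = concatMap (λ x → map (x ∷_) (allVecs xs k)) xs

allWorlds : (n : ℕ) (s : Sig) → List (World n s)
allWorlds n (preds k a) = allVecs (allVecs (true ∷ false ∷ []) (n ^ a)) k
allWorlds n (s ⊕ t)     = cartesianProduct (allWorlds n s) (allWorlds n t)

countTrue : ∀ {m} → Vec Bool m → ℕ
countTrue []           = 0
countTrue (true ∷ bs)  = suc (countTrue bs)
countTrue (false ∷ bs) = countTrue bs

-- Variables are de Bruijn indices.

data Term (n m : ℕ) : Set where
  var   : Fin m → Term n m
  const : Fin n → Term n m

data CardOp : Set where
  le ge eq lt gt ne : CardOp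

data Formula (s : Sig) (n : ℕ) : ℕ → Set where
  atom  : ∀ {m} (p : Pred s) → Vec (Term n m) (arity s p) → Formula s n m
  equal : ∀ {m} → Term n m → Term n m → Formula s n m
  card  : ∀ {m} (p : Pred s) → CardOp → ℕ → Formula s n m
  ⊤f ⊥f : ∀ {m} → Formula s n m
  ¬f    : ∀ {m} → Formula s n m → Formula s n m
  _∧f_ _∨f_ _⇒f_ _⇔f_ : ∀ {m} → Formula s n m → Formula s n m → Formula s n m
  ∀f ∃f : ∀ {m} → Formula s n (suc m) → Formula s n m

Sentence : Sig → ℕ → Set
Sentence s n = Formula s n 0

evalTerm : ∀ {n m} → (Fin m → Fin n) → Term n m → Fin n
evalTerm ρ (var i)   = ρ i
evalTerm ρ (const c) = c

evalTerms : ∀ {n m k} → (Fin m → Fin n) → Vec (Term n m) k → Vec (Fin n) k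
evalTerms ρ []       = []
evalTerms ρ (t ∷ ts) = evalTerm ρ t ∷ evalTerms ρ ts

extend : ∀ {n m} → Fin n → (Fin m → Fin n) → Fin (suc m) → Fin n
extend a ρ zero    = a
extend a ρ (suc i) = ρ i

cmp : CardOp → ℕ → ℕ → Bool
cmp le x k = x ≤ᵇ k
cmp ge x k = k ≤ᵇ x
cmp eq x k = x ≡ᵇ k
cmp lt x k = suc x ≤ᵇ k
cmp gt x k = suc k ≤ᵇ x
cmp ne x k = not (x ≡ᵇ k)

_⇒b_ : Bool → Bool → Bool
a ⇒b b = not a ∨ b

_⇔b_ : Bool → Bool → Bool
true  ⇔b b = b
false ⇔b b = not b

sat : ∀ {n m} (s : Sig) → World n s → Formula s n m → (Fin m → Fin n) → Bool
sat s μ (atom p ts)   ρ = holds s μ p (evalTerms ρ ts)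
sat s μ (equal t t′)  ρ = ⌊ evalTerm ρ t ≟ᶠ evalTerm ρ t′ ⌋
sat s μ (card p o k)  ρ = cmp o (countTrue (table s μ p)) k
sat s μ ⊤f            ρ = true
sat s μ ⊥f            ρ = false
sat s μ (¬f φ)        ρ = not (sat s μ φ ρ)
sat s μ (φ ∧f ψ)      ρ = sat s μ φ ρ ∧ sat s μ ψ ρ
sat s μ (φ ∨f ψ)      ρ = sat s μ φ ρ ∨ sat s μ ψ ρ
sat s μ (φ ⇒f ψ)      ρ = sat s μ φ ρ ⇒b sat s μ ψ ρ
sat s μ (φ ⇔f ψ)      ρ = sat s μ φ ρ ⇔b sat s μ ψ ρ
sat {n} s μ (∀f φ)    ρ = all (λ a → sat s μ φ (extend a ρ)) (allFin n)
sat {n} s μ (∃f φ)    ρ = any (λ a → sat s μ φ (extend a ρ)) (allFin n)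

noEnv : ∀ {n} → Fin 0 → Fin n
noEnv ()

models : ∀ {n} (s : Sig) → World n s → Sentence s n → Bool
models s μ Ψ = sat s μ Ψ noEnv

Ratom : ∀ {n m} (s : Sig) (R : Pred s) → arity s R ≡ 2 → Term n m → Term n m → Formula s n m
Ratom {n} {m} s R r2 x y = atom R (subst (Vec (Term n m)) (sym r2) (x ∷ y ∷ []))

Rholds : ∀ {n} (s : Sig) (R : Pred s) → arity s R ≡ 2 → World n s → Fin n → Fin n → Bool
Rholds {n} s R r2 μ a b = holds s μ R (subst (Vec (Fin n)) (sym r2) (a ∷ b ∷ []))

SymmetricInModels : (s : Sig) (R : Pred s) → arity s R ≡ 2 → (n : ℕ) → Sentence s n → Set
SymmetricInModels s R r2 n Ψ =
  (μ : World n s) → models s μ Ψ ≡ true →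
  (a b : Fin n) → Rholds s R r2 μ a b ≡ Rholds s R r2 μ b a

adj : ∀ {n} (s : Sig) (R : Pred s) → arity s R ≡ 2 → World n s → Fin n → Fin n → Bool
adj s R r2 μ a b = Rholds s R r2 μ a b ∨ Rholds s R r2 μ b a

reachWithin : ∀ {n} (s : Sig) (R : Pred s) → arity s R ≡ 2 → World n s → ℕ → Fin n → Fin n → Bool
reachWithin s R r2 μ zero    a b = ⌊ a ≟ᶠ b ⌋
reachWithin {n} s R r2 μ (suc k) a b =
  reachWithin s R r2 μ k a b ∨
  any (λ c → reachWithin s R r2 μ k a c ∧ adj s R r2 μ c b) (allFin n)

-- a and b lie in the same connected component of G(μ_R)
-- (walks of length ≤ n suffice on n vertices)
connected : ∀ {n} (s : Sig) (R : Pred s) → arity s R ≡ 2 → World n s → Fin n → Fin n → Bool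
connected {n} s R r2 μ a b = reachWithin s R r2 μ n a b

countList : ∀ {A : Set} → (A → Bool) → List A → ℕ
countList P []       = 0
countList P (x ∷ xs) = if P x then suc (countList P xs) else countList P xs

-- cc(μ_R): number of connected components of G(μ_R), counted as the
-- number of vertices that are the least element of their component
cc : ∀ {n} (s : Sig) (R : Pred s) → arity s R ≡ 2 → World n s → ℕ
cc {n} s R r2 μ =
  countList (λ a → not (any (λ b → ⌊ b <?ᶠ a ⌋ ∧ connected s R r2 μ a b) (allFin n))) (allFin n)

twoE : ∀ {n} (s : Sig) (R : Pred s) → World n s → ℕ
twoE s R μ = countTrue (table s μ R)

-- The extended sentence Ψ_{R,u}: fresh unary predicates A_1..A_u are
-- the block  preds u 1  (A_i is index i-1 : Fin u) placed in front.

ExtSig : ℕ → Sig → Sig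
ExtSig u s = preds u 1 ⊕ s

liftF : ∀ {u n m} (s : Sig) → Formula s n m → Formula (ExtSig u s) n m
liftF s (atom p ts)  = atom (inj₂ p) ts
liftF s (equal t t′) = equal t t′
liftF s (card p o k) = card (inj₂ p) o k
liftF s ⊤f           = ⊤f
liftF s ⊥f           = ⊥f
liftF s (¬f φ)       = ¬f (liftF s φ)
liftF s (φ ∧f ψ)     = liftF s φ ∧f liftF s ψ
liftF s (φ ∨f ψ)     = liftF s φ ∨f liftF s ψ
liftF s (φ ⇒f ψ)     = liftF s φ ⇒f liftF s ψ
liftF s (φ ⇔f ψ)     = liftF s φ ⇔f liftF s ψ
liftF s (∀f φ)       = ∀f (liftF s φ)
liftF s (∃f φ)       = ∃f (liftF s φ)

bigAnd : ∀ {s n m} → List (Formula s n m) → Formula s n m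
bigAnd = foldr _∧f_ ⊤f

Aatom : ∀ {u n m} (s : Sig) → Fin u → Term n m → Formula (ExtSig u s) n m
Aatom s i x = atom (inj₁ i) (x ∷ [])

closureAx : ∀ {u n} (s : Sig) (R : Pred s) → arity s R ≡ 2 → Fin u → Sentence (ExtSig u s) n
closureAx {u} s R r2 i =
  ∀f (∀f ((Aatom s i x ∧f (Ratom (ExtSig u s) (inj₂ R) r2 x y ∨f Ratom (ExtSig u s) (inj₂ R) r2 y x))
          ⇒f Aatom s i y))
  where
    x = var (suc zero)
    y = var zero

-- for i = 2..u :  ∀x (A_i(x) → A_{i-1}(x));  index zero (A_1) gives ⊤
chainAx : ∀ {u n} (s : Sig) → Fin u → Sentence (ExtSig u s) n
chainAx s zero    = ⊤f
chainAx s (suc j) = ∀f (Aatom s (suc j) (var zero) ⇒f Aatom s (inject₁ j) (var zero))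

PsiRu : ∀ {n} (s : Sig) (R : Pred s) → arity s R ≡ 2 → (u : ℕ) → Sentence s n → Sentence (ExtSig u s) n
PsiRu s R r2 u Ψ =
  liftF s Ψ ∧f (bigAnd (map (closureAx s R r2) (allFin u)) ∧f bigAnd (map (chainAx s) (allFin u)))

module _ {c ℓ} (Rg : CommutativeRing c ℓ) where
  open CommutativeRing Rg

  ∏ : List Carrier → Carrier
  ∏ = foldr _*_ 1#

  ∑ : List Carrier → Carrier
  ∑ = foldr _+_ 0#

  ∏Vec : ∀ {m} → (Bool → Carrier) → Vec Bool m → Carrier
  ∏Vec f []       = 1#
  ∏Vec f (b ∷ bs) = f b * ∏Vec f bs

  pow : Carrier → ℕ → Carrier
  pow x zero    = 1#
  pow x (suc k) = x * pow x k

  fromℕ : ℕ → Carrier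
  fromℕ zero    = 0#
  fromℕ (suc k) = 1# + fromℕ k

  weight : ∀ {n} (s : Sig) → World n s → (w w̄ : Pred s → Carrier) → Carrier
  weight (preds k a) μ w w̄ =
    ∏ (map (λ i → ∏Vec (λ b → if b then w i else w̄ i) (lookup μ i)) (allFin k))
  weight (s ⊕ t) (μ , ν) w w̄ =
    weight s μ (λ p → w (inj₁ p)) (λ p → w̄ (inj₁ p)) * weight t ν (λ p → w (inj₂ p)) (λ p → w̄ (inj₂ p))

  sumOverModels : (s : Sig) (n : ℕ) → Sentence s n → (World n s → Carrier) → Carrier
  sumOverModels s n Ψ F = ∑ (map (λ μ → if models s μ Ψ then F μ else 0#) (allWorlds n s))

  WFOMC : (s : Sig) (n : ℕ) → Sentence s n → (w w̄ : Pred s → Carrier) → Carrier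
  WFOMC s n Ψ w w̄ = sumOverModels s n Ψ (λ μ → weight s μ w w̄)

  extWeightRv : (s : Sig) (R : Pred s) (u : ℕ) (w : Pred s → Carrier) (v : Carrier) → Pred (ExtSig u s) → Carrier
  extWeightRv s R u w v (inj₁ i) = 1#
  extWeightRv s R u w v (inj₂ p) = if predEq s p R then v * w p else w p

  extWeightBar : (s : Sig) (u : ℕ) (w̄ : Pred s → Carrier) → Pred (ExtSig u s) → Carrier
  extWeightBar s u w̄ (inj₁ i) = 1#
  extWeightBar s u w̄ (inj₂ p) = w̄ p

  -- f_n(u, v; Ψ, w, w̄, R) at a positive integer u and ring element v:
  -- WFOMC(Ψ_{R,u}, n, w_{R,v}, w̄)
  extWeakConnPoly : (s : Sig) (R : Pred s) → arity s R ≡ 2 → (n : ℕ) → Sentence s n →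
                    (w w̄ : Pred s → Carrier) → (u : ℕ) → Carrier → Carrier
  extWeakConnPoly s R r2 n Ψ w w̄ u v =
    WFOMC (ExtSig u s) n (PsiRu s R r2 u Ψ) (extWeightRv s R u w v) (extWeightBar s u w̄)

module Submission where

-- A model of Ψ_{R,u} is a pair (A, μ) with μ ⊨ Ψ and A_u ⊆ … ⊆ A_1 unions of connected
-- components of G(μ_R); since w(A_i) = w̄(A_i) = 1, its weight is W(μ, w, w̄) · v^{#true R-atoms}.
-- Read column by column, A colours each vertex a by the vector (A_1(a), …, A_u(a)), which is
-- descending (u + 1 possibilities), and the closure axioms say exactly that this colouring is
-- constant on components. It is therefore determined by free choices at the least vertex of each
-- component, so every model μ of Ψ is counted (u + 1)^{cc(μ_R)} times.

open import Defs
open import Algebra.Bundles using (CommutativeSemiring; CommutativeRing)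
open import Data.Bool using (Bool; true; false; _∧_; _∨_; not; if_then_else_; T)
import Data.Bool as Bool
open import Data.Bool.Properties using (T-≡; T-∧; T-∨; ∧-identityʳ; ∧-zeroʳ; ∨-comm)
open import Data.Bool.ListAction using (and; or; all; any)
open import Data.Fin using (Fin; zero; suc; _<_; _≤_; _<?_; fromℕ<; combine; inject₁) renaming (_≟_ to _≟ᶠ_)
open import Data.Fin.Properties
  using (suc-injective; ≤∧≢⇒<; <-cmp; ¬∀⟶∃¬-smallest; ¬∀⟶∃¬; all?; toℕ-injective; toℕ-inject; toℕ-fromℕ<)
open import Data.List using (List; []; _∷_; _++_; foldr; map; concatMap; cartesianProduct; allFin; tabulate; length)
open import Data.List.Membership.Propositional using (_∈_)
open import Data.List.Membership.Propositional.Properties using (∈-allFin)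
open import Data.List.Properties using (map-tabulate; map-∘; map-cong; length-tabulate)
open import Data.List.Relation.Unary.Any using (here; there)
import Data.List.Relation.Unary.All.Properties as All
import Data.List.Relation.Unary.Any.Properties as Any
open import Data.Nat using (ℕ; zero; suc; s≤s)
import Data.Nat as ℕ
import Data.Nat.Properties as ℕ
open import Data.Product using (∃; _×_; _,_; proj₁; proj₂)
open import Data.Sum using (_⊎_; inj₁; inj₂)
open import Data.Unit using (⊤)
open import Data.Vec using (Vec; []; _∷_; lookup; replicate; transpose; _⊛_)
open import Data.Vec.Properties using (≡-dec; lookup-⊛; lookup-replicate; tabulate∘lookup; tabulate-cong)
open import Function using (_∘_; _⇔_; mk⇔; case_of_)
open import Function.Bundles using (module Equivalence)
open import Relation.Binary using (tri<; tri≈; tri>)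
open import Relation.Binary.Definitions using (DecidableEquality)
open import Relation.Binary.PropositionalEquality
  using (_≡_; _≢_; refl; sym; trans; cong; cong₂; cong-app; subst; ≡-≟-identity; ≢-≟-identity; module ≡-Reasoning)
open import Relation.Nullary using (¬_; contradiction)
open import Relation.Nullary.Decidable using (Dec; ⌊_⌋; yes; no; ¬?; T?; _→-dec_; decidable-stable; toWitness; fromWitness)
open import Relation.Unary using (Decidable)

T-ext : ∀ {a b} → (T a → T b) → (T b → T a) → a ≡ b
T-ext {false} {false} _ _ = refl
T-ext {false} {true}  _ g with () ← g _
T-ext {true}  {false} f _ with () ← f _
T-ext {true}  {true}  _ _ = refl

T-not : ∀ {x} → T (not x) ⇔ (¬ T x)
T-not {true}  = mk⇔ (λ ()) (λ ¬t → ¬t _)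
T-not {false} = mk⇔ (λ _ ()) (λ _ → _)

T-⇒b : ∀ {x y} → T (x ⇒b y) ⇔ (T x → T y)
T-⇒b {true}  {true}  = mk⇔ (λ _ _ → _) (λ _ → _)
T-⇒b {true}  {false} = mk⇔ (λ ()) (λ h → h _)
T-⇒b {false}         = mk⇔ (λ _ ()) (λ _ → _)

¬[T→T] : ∀ {x y} → ¬ (T x → T y) → T x × ¬ T y
¬[T→T] {true}  {false} _ = _ , λ ()
¬[T→T] {true}  {true}  h = contradiction (λ _ → _) h
¬[T→T] {false}         h = contradiction (λ ()) h

all-cong : ∀ {A : Set} {p q : A → Bool} → (∀ x → p x ≡ q x) → ∀ xs → all p xs ≡ all q xs
all-cong p≡q xs = cong and (map-cong p≡q xs)

all-map : ∀ {A B : Set} (p : B → Bool) (f : A → B) xs → all p (map f xs) ≡ all (p ∘ f) xs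
all-map p f xs = cong and (sym (map-∘ xs))

all-allFin-suc : ∀ {n} (p : Fin (suc n) → Bool) → all p (allFin (suc n)) ≡ p zero ∧ all (p ∘ suc) (allFin n)
all-allFin-suc p = cong (p zero ∧_) (trans (cong (all p) (sym (map-tabulate (λ i → i) suc))) (all-map p suc (allFin _)))

T-all-allFin : ∀ {n} (p : Fin n → Bool) → T (all p (allFin n)) ⇔ (∀ i → T (p i))
T-all-allFin p = mk⇔ (All.tabulate⁻ ∘ All.all⁺ p _) (All.all⁻ p ∘ All.tabulate⁺)

T-any-allFin : ∀ {n} (p : Fin n → Bool) → T (any p (allFin n)) ⇔ ∃ (T ∘ p)
T-any-allFin p = mk⇔ (Any.tabulate⁻ ∘ Any.any⁻ p _) (λ (i , pi) → Any.any⁺ p (Any.tabulate⁺ i pi))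

≡-dec-∷ : ∀ {X : Set} (_≟_ : DecidableEquality X) {k} x y (v w : Vec X k) →
          ⌊ ≡-dec _≟_ (x ∷ v) (y ∷ w) ⌋ ≡ ⌊ x ≟ y ⌋ ∧ ⌊ ≡-dec _≟_ v w ⌋
≡-dec-∷ _≟_ x y v w with x ≟ y | ≡-dec _≟_ v w
... | yes _ | yes _ = refl
... | yes _ | no _  = refl
... | no _  | _     = refl

lookup-ext : ∀ {A : Set} {k} {v w : Vec A k} → (∀ i → lookup v i ≡ lookup w i) → v ≡ w
lookup-ext {v = v} {w} v≗w = trans (sym (tabulate∘lookup v)) (trans (tabulate-cong v≗w) (tabulate∘lookup w))

-- World n (preds u 1) stores truth tables of length n ^ 1, which reduces to n * 1, not to n
widen : ∀ {A : Set} {k} → Vec A k → Vec A (k ℕ.* 1)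
widen []      = []
widen (x ∷ v) = x ∷ widen v

lookup-widen : ∀ {A : Set} {k} (v : Vec A k) a → lookup (widen v) (combine a zero) ≡ lookup v a
lookup-widen (x ∷ v) zero    = refl
lookup-widen (x ∷ v) (suc a) = lookup-widen v a

lookup-transpose : ∀ {A : Set} {u k} (C : Vec (Vec A u) k) i a → lookup (lookup (transpose C) i) a ≡ lookup (lookup C a) i
lookup-transpose {A} {u} {suc k} (c ∷ C) i a = trans (cong (λ v → lookup v a) lookup-i) (lookup-∷ a)
  where
  lookup-i : lookup (transpose (c ∷ C)) i ≡ lookup c i ∷ lookup (transpose C) i
  lookup-i = trans (lookup-⊛ i (replicate u (_∷_ {A = A} {n = k}) ⊛ c) (transpose C))
    (cong-app (trans (lookup-⊛ i (replicate u _∷_) c) (cong-app (lookup-replicate i _∷_) (lookup c i)))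
              (lookup (transpose C) i))
  lookup-∷ : ∀ a → lookup (lookup c i ∷ lookup (transpose C) i) a ≡ lookup (lookup (c ∷ C) a) i
  lookup-∷ zero    = refl
  lookup-∷ (suc a) = lookup-transpose C i a

-- Sums over lists

module ListSum {c ℓ} (S : CommutativeSemiring c ℓ) where
  open CommutativeSemiring S renaming (refl to ≈-refl; sym to ≈-sym; trans to ≈-trans)
  open import Algebra.Properties.CommutativeSemigroup +-commutativeSemigroup using (interchange)
  open import Relation.Binary.Reasoning.Setoid setoid

  sumOver : ∀ {A : Set} → (A → Carrier) → List A → Carrier
  sumOver f xs = foldr _+_ 0# (map f xs)

  syntax sumOver (λ x → e) xs = ∑[ x ∈ xs ] e

  ∑-cong : ∀ {A : Set} {f g : A → Carrier} (xs : List A) →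
           (∀ x → f x ≈ g x) → sumOver f xs ≈ sumOver g xs
  ∑-cong []       f≈g = ≈-refl
  ∑-cong (x ∷ xs) f≈g = +-cong (f≈g x) (∑-cong xs f≈g)

  ∑-++ : ∀ {A : Set} (f : A → Carrier) (xs ys : List A) →
         sumOver f (xs ++ ys) ≈ sumOver f xs + sumOver f ys
  ∑-++ f []       ys = ≈-sym (+-identityˡ _)
  ∑-++ f (x ∷ xs) ys = ≈-trans (+-cong ≈-refl (∑-++ f xs ys)) (≈-sym (+-assoc _ _ _))

  ∑-map : ∀ {A B : Set} (f : B → Carrier) (g : A → B) (xs : List A) →
          sumOver f (map g xs) ≈ sumOver (f ∘ g) xs
  ∑-map f g []       = ≈-refl
  ∑-map f g (x ∷ xs) = +-cong ≈-refl (∑-map f g xs)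

  ∑-concatMap : ∀ {A B : Set} (f : B → Carrier) (g : A → List B) (xs : List A) →
                sumOver f (concatMap g xs) ≈ ∑[ x ∈ xs ] sumOver f (g x)
  ∑-concatMap f g []       = ≈-refl
  ∑-concatMap f g (x ∷ xs) = ≈-trans (∑-++ f (g x) _) (+-cong ≈-refl (∑-concatMap f g xs))

  ∑-zero : ∀ {A : Set} (xs : List A) → ∑[ x ∈ xs ] 0# ≈ 0#
  ∑-zero []       = ≈-refl
  ∑-zero (x ∷ xs) = ≈-trans (+-identityˡ _) (∑-zero xs)

  ∑-distrib-+ : ∀ {A : Set} (f g : A → Carrier) (xs : List A) →
                ∑[ x ∈ xs ] (f x + g x) ≈ sumOver f xs + sumOver g xs
  ∑-distrib-+ f g []       = ≈-sym (+-identityˡ _)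
  ∑-distrib-+ f g (x ∷ xs) = ≈-trans (+-cong ≈-refl (∑-distrib-+ f g xs)) (interchange _ _ _ _)

  ∑-comm : ∀ {A B : Set} (f : A → B → Carrier) (xs : List A) (ys : List B) →
           ∑[ x ∈ xs ] ∑[ y ∈ ys ] f x y ≈ ∑[ y ∈ ys ] ∑[ x ∈ xs ] f x y
  ∑-comm f []       ys = ≈-sym (∑-zero ys)
  ∑-comm f (x ∷ xs) ys = ≈-trans (+-cong ≈-refl (∑-comm f xs ys)) (≈-sym (∑-distrib-+ (f x) _ ys))

  ∑-cartesianProduct : ∀ {A B : Set} (f : A × B → Carrier) (xs : List A) (ys : List B) →
                       sumOver f (cartesianProduct xs ys) ≈ ∑[ x ∈ xs ] ∑[ y ∈ ys ] f (x , y)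
  ∑-cartesianProduct f []       ys = ≈-refl
  ∑-cartesianProduct f (x ∷ xs) ys = begin
    sumOver f (map (x ,_) ys ++ cartesianProduct xs ys)
      ≈⟨ ∑-++ f (map (x ,_) ys) _ ⟩
    sumOver f (map (x ,_) ys) + sumOver f (cartesianProduct xs ys)
      ≈⟨ +-cong (∑-map f (x ,_) ys) (∑-cartesianProduct f xs ys) ⟩
    ∑[ y ∈ ys ] f (x , y) + ∑[ x ∈ xs ] ∑[ y ∈ ys ] f (x , y) ∎

  ∑-allVecs-suc : ∀ {A : Set} {k} (f : Vec A (suc k) → Carrier) (xs : List A) →
                  sumOver f (allVecs xs (suc k)) ≈ ∑[ x ∈ xs ] ∑[ v ∈ allVecs xs k ] f (x ∷ v)
  ∑-allVecs-suc {k = k} f xs = ≈-trans (∑-concatMap f _ xs) (∑-cong xs λ x → ∑-map f (x ∷_) (allVecs xs k))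

  ∑-widen : ∀ {A : Set} {k} (f : Vec A (k ℕ.* 1) → Carrier) (xs : List A) →
            sumOver f (allVecs xs (k ℕ.* 1)) ≈ ∑[ v ∈ allVecs xs k ] f (widen v)
  ∑-widen {k = zero}  f xs = ≈-refl
  ∑-widen {k = suc k} f xs = ≈-trans (∑-allVecs-suc f xs) (≈-trans
    (∑-cong xs (λ x → ∑-widen {k = k} (f ∘ (x ∷_)) xs)) (≈-sym (∑-allVecs-suc {k = k} (f ∘ widen) xs)))

  ∑-allVecs-singleton : ∀ {A : Set} {k} (f : Vec A k → Carrier) (x : A) →
                        sumOver f (allVecs (x ∷ []) k) ≈ f (replicate k x)
  ∑-allVecs-singleton {k = zero}  f x = +-identityʳ _
  ∑-allVecs-singleton {k = suc k} f x =
    ≈-trans (∑-allVecs-suc f (x ∷ [])) (≈-trans (+-identityʳ _) (∑-allVecs-singleton (f ∘ (x ∷_)) x))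

  ∑-allVecs-cons-columns : ∀ {B : Set} {u k} (f : Vec (Vec B (suc k)) u → Carrier) (bs : List B) →
    sumOver f (allVecs (allVecs bs (suc k)) u) ≈
    ∑[ c ∈ allVecs bs u ] ∑[ A ∈ allVecs (allVecs bs k) u ] f (replicate u _∷_ ⊛ c ⊛ A)
  ∑-allVecs-cons-columns {u = zero}  f bs = ≈-sym (+-identityʳ _)
  ∑-allVecs-cons-columns {B} {suc u} {k} f bs = begin
    sumOver f (allVecs rows (suc u))
      ≈⟨ ∑-allVecs-suc f rows ⟩
    ∑[ r ∈ rows ] ∑[ A ∈ allVecs rows u ] f (r ∷ A)
      ≈⟨ ∑-cong rows (λ r → ∑-allVecs-cons-columns (f ∘ (r ∷_)) bs) ⟩
    ∑[ r ∈ rows ] ∑[ c ∈ allVecs bs u ] ∑[ A ∈ allVecs rows′ u ] f (r ∷ (replicate u _∷_ ⊛ c ⊛ A))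
      ≈⟨ ∑-allVecs-suc _ bs ⟩
    ∑[ b ∈ bs ] ∑[ r ∈ rows′ ] ∑[ c ∈ allVecs bs u ] ∑[ A ∈ allVecs rows′ u ]
      f ((b ∷ r) ∷ (replicate u _∷_ ⊛ c ⊛ A))
      ≈⟨ ∑-cong bs (λ b → ∑-comm _ rows′ (allVecs bs u)) ⟩
    ∑[ b ∈ bs ] ∑[ c ∈ allVecs bs u ] ∑[ r ∈ rows′ ] ∑[ A ∈ allVecs rows′ u ]
      f ((b ∷ r) ∷ (replicate u _∷_ ⊛ c ⊛ A))
      ≈⟨ ∑-cong bs (λ b → ∑-cong (allVecs bs u) λ c → ≈-sym (∑-allVecs-suc _ rows′)) ⟩
    ∑[ b ∈ bs ] ∑[ c ∈ allVecs bs u ] ∑[ A ∈ allVecs rows′ (suc u) ] f (replicate (suc u) _∷_ ⊛ (b ∷ c) ⊛ A)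
      ≈⟨ ≈-sym (∑-allVecs-suc _ bs) ⟩
    ∑[ c ∈ allVecs bs (suc u) ] ∑[ A ∈ allVecs rows′ (suc u) ] f (replicate (suc u) _∷_ ⊛ c ⊛ A) ∎
    where
    rows : List (Vec B (suc k))
    rows = allVecs bs (suc k)
    rows′ : List (Vec B k)
    rows′ = allVecs bs k

  ∑-transpose : ∀ {B : Set} {u k} (f : Vec (Vec B k) u → Carrier) (bs : List B) →
    sumOver f (allVecs (allVecs bs k) u) ≈ ∑[ C ∈ allVecs (allVecs bs u) k ] f (transpose C)
  ∑-transpose {k = zero}  f bs = ≈-trans (∑-allVecs-singleton f []) (≈-sym (+-identityʳ _))
  ∑-transpose {k = suc k} f bs = begin
    sumOver f (allVecs (allVecs bs (suc k)) _)
      ≈⟨ ∑-allVecs-cons-columns f bs ⟩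
    ∑[ c ∈ allVecs bs _ ] ∑[ A ∈ allVecs (allVecs bs k) _ ] f (replicate _ _∷_ ⊛ c ⊛ A)
      ≈⟨ ∑-cong (allVecs bs _) (λ c → ∑-transpose (λ A → f (replicate _ _∷_ ⊛ c ⊛ A)) bs) ⟩
    ∑[ c ∈ allVecs bs _ ] ∑[ C ∈ allVecs (allVecs bs _) k ] f (transpose (c ∷ C))
      ≈⟨ ≈-sym (∑-allVecs-suc (f ∘ transpose) (allVecs bs _)) ⟩
    ∑[ C ∈ allVecs (allVecs bs _) (suc k) ] f (transpose C) ∎

module Weighted {c ℓ} (Rg : CommutativeRing c ℓ) where
  open CommutativeRing Rg hiding (zero)
    renaming (refl to ≈-refl; sym to ≈-sym; trans to ≈-trans; reflexive to ≈-reflexive)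
  open ListSum commutativeSemiring
  open import Algebra.Properties.CommutativeSemigroup *-commutativeSemigroup using (interchange; xy∙z≈xz∙y)
  open import Algebra.Properties.Semiring.Mult semiring using (×1-homo-*) renaming (_×_ to _×ᴹ_)
  open import Relation.Binary.Reasoning.Setoid setoid

  fromℕ≡×1# : ∀ k → fromℕ Rg k ≡ k ×ᴹ 1#
  fromℕ≡×1# zero    = refl
  fromℕ≡×1# (suc k) = cong (1# +_) (fromℕ≡×1# k)

  fromℕ-* : ∀ a b → fromℕ Rg (a ℕ.* b) ≈ fromℕ Rg a * fromℕ Rg b
  fromℕ-* a b rewrite fromℕ≡×1# (a ℕ.* b) | fromℕ≡×1# a | fromℕ≡×1# b = ×1-homo-* a b

  fromℕ-^ : ∀ a k → fromℕ Rg (a ℕ.^ k) ≈ pow Rg (fromℕ Rg a) k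
  fromℕ-^ a zero    = +-identityʳ 1#
  fromℕ-^ a (suc k) = ≈-trans (fromℕ-* a (a ℕ.^ k)) (*-cong ≈-refl (fromℕ-^ a k))

  if-cong : ∀ b {x y} → x ≈ y → (if b then x else 0#) ≈ (if b then y else 0#)
  if-cong true  x≈y = x≈y
  if-cong false _   = ≈-refl

  ∑-if : ∀ {A : Set} (p : A → Bool) (x : Carrier) (xs : List A) →
         ∑[ a ∈ xs ] (if p a then x else 0#) ≈ fromℕ Rg (countList p xs) * x
  ∑-if p x []       = ≈-sym (zeroˡ x)
  ∑-if p x (a ∷ xs) with p a
  ... | true  = ≈-trans (+-cong (≈-sym (*-identityˡ x)) (∑-if p x xs)) (≈-sym (distribʳ x 1# _))
  ... | false = ≈-trans (+-identityˡ _) (∑-if p x xs)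

  ∏-cong : ∀ {A : Set} {f g : A → Carrier} (xs : List A) → (∀ x → f x ≈ g x) →
           ∏ Rg (map f xs) ≈ ∏ Rg (map g xs)
  ∏-cong []       f≈g = ≈-refl
  ∏-cong (x ∷ xs) f≈g = *-cong (f≈g x) (∏-cong xs f≈g)

  ∏-ones : ∀ {A : Set} (xs : List A) → ∏ Rg (map (λ _ → 1#) xs) ≈ 1#
  ∏-ones []       = ≈-refl
  ∏-ones (x ∷ xs) = ≈-trans (*-identityˡ _) (∏-ones xs)

  ∏-allFin-suc : ∀ {k} (f : Fin (suc k) → Carrier) →
                 ∏ Rg (map f (allFin (suc k))) ≡ f zero * ∏ Rg (map (f ∘ suc) (allFin k))
  ∏-allFin-suc f =
    cong (λ fs → f zero * ∏ Rg fs) (trans (map-tabulate suc f) (sym (map-tabulate (λ i → i) (f ∘ suc))))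

  ∏-one-factor : ∀ {k} {f g : Fin k → Carrier} (j : Fin k) {z} →
                 (∀ i → i ≢ j → f i ≈ g i) → f j ≈ g j * z →
                 ∏ Rg (map f (allFin k)) ≈ ∏ Rg (map g (allFin k)) * z
  ∏-one-factor {suc k} {f} {g} zero {z} f≈g fj≈ = begin
    ∏ Rg (map f (allFin (suc k)))               ≡⟨ ∏-allFin-suc f ⟩
    f zero * ∏ Rg (map (f ∘ suc) (allFin k))    ≈⟨ *-cong fj≈ (∏-cong (allFin k) λ i → f≈g (suc i) λ ()) ⟩
    (g zero * z) * ∏ Rg (map (g ∘ suc) (allFin k)) ≈⟨ xy∙z≈xz∙y _ _ _ ⟩
    (g zero * ∏ Rg (map (g ∘ suc) (allFin k))) * z ≡⟨ cong (_* z) (sym (∏-allFin-suc g)) ⟩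
    ∏ Rg (map g (allFin (suc k))) * z           ∎
  ∏-one-factor {suc k} {f} {g} (suc j) {z} f≈g fj≈ = begin
    ∏ Rg (map f (allFin (suc k)))               ≡⟨ ∏-allFin-suc f ⟩
    f zero * ∏ Rg (map (f ∘ suc) (allFin k))    ≈⟨ *-cong (f≈g zero λ ()) (∏-one-factor j f≈g∘suc fj≈) ⟩
    g zero * (∏ Rg (map (g ∘ suc) (allFin k)) * z) ≈⟨ *-assoc _ _ _ ⟨
    (g zero * ∏ Rg (map (g ∘ suc) (allFin k))) * z ≡⟨ cong (_* z) (sym (∏-allFin-suc g)) ⟩
    ∏ Rg (map g (allFin (suc k))) * z           ∎
    where
    f≈g∘suc : ∀ i → i ≢ j → f (suc i) ≈ g (suc i)
    f≈g∘suc i i≢j = f≈g (suc i) (i≢j ∘ suc-injective)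

  ∏Vec-scale : ∀ {k} (v x y : Carrier) (bs : Vec Bool k) →
               ∏Vec Rg (λ b → if b then v * x else y) bs ≈
               ∏Vec Rg (λ b → if b then x else y) bs * pow Rg v (countTrue bs)
  ∏Vec-scale v x y []           = ≈-sym (*-identityʳ 1#)
  ∏Vec-scale v x y (true ∷ bs)  = ≈-trans (*-cong (*-comm v x) (∏Vec-scale v x y bs)) (interchange x v _ _)
  ∏Vec-scale v x y (false ∷ bs) = ≈-trans (*-cong ≈-refl (∏Vec-scale v x y bs)) (≈-sym (*-assoc _ _ _))

  weight-scale : ∀ {n} (s : Sig) (μ : World n s) (R : Pred s) (w w̄ : Pred s → Carrier) (v : Carrier) →
                 weight Rg s μ (λ p → if predEq s p R then v * w p else w p) w̄ ≈
                 weight Rg s μ w w̄ * pow Rg v (twoE s R μ)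
  weight-scale (preds k a) μ R w w̄ v = ∏-one-factor R off-R at-R
    where
    off-R : ∀ i → i ≢ R → ∏Vec Rg (λ b → if b then (if ⌊ i ≟ᶠ R ⌋ then v * w i else w i) else w̄ i) (lookup μ i)
                        ≈ ∏Vec Rg (λ b → if b then w i else w̄ i) (lookup μ i)
    off-R i i≢R rewrite ≢-≟-identity _≟ᶠ_ i≢R = ≈-refl
    at-R : ∏Vec Rg (λ b → if b then (if ⌊ R ≟ᶠ R ⌋ then v * w R else w R) else w̄ R) (lookup μ R)
           ≈ ∏Vec Rg (λ b → if b then w R else w̄ R) (lookup μ R) * pow Rg v (countTrue (lookup μ R))
    at-R rewrite ≡-≟-identity _≟ᶠ_ {R} refl = ∏Vec-scale v (w R) (w̄ R) (lookup μ R)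
  weight-scale (s ⊕ t) (μ , ν) (inj₁ R) w w̄ v =
    ≈-trans (*-cong (weight-scale s μ R (w ∘ inj₁) (w̄ ∘ inj₁) v) ≈-refl) (xy∙z≈xz∙y _ _ _)
  weight-scale (s ⊕ t) (μ , ν) (inj₂ R) w w̄ v =
    ≈-trans (*-cong ≈-refl (weight-scale t ν R (w ∘ inj₂) (w̄ ∘ inj₂) v)) (≈-sym (*-assoc _ _ _))

  weight-ones : ∀ {n k a} (A : World n (preds k a)) → weight Rg (preds k a) A (λ _ → 1#) (λ _ → 1#) ≈ 1#
  weight-ones {k = k} A = ≈-trans (∏-cong (allFin k) (λ i → ∏Vec-ones (lookup A i))) (∏-ones (allFin k))
    where
    ∏Vec-ones : ∀ {m} (bs : Vec Bool m) → ∏Vec Rg (λ b → if b then 1# else 1#) bs ≈ 1#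
    ∏Vec-ones []           = ≈-refl
    ∏Vec-ones (true ∷ bs)  = ≈-trans (*-identityˡ _) (∏Vec-ones bs)
    ∏Vec-ones (false ∷ bs) = ≈-trans (*-identityˡ _) (∏Vec-ones bs)

  weight-extension : ∀ {n u} (s : Sig) (R : Pred s) (A : World n (preds u 1)) (μ : World n s)
                       (w w̄ : Pred s → Carrier) v →
                     weight Rg (ExtSig u s) (A , μ) (extWeightRv Rg s R u w v) (extWeightBar Rg s u w̄) ≈
                     weight Rg s μ w w̄ * pow Rg v (twoE s R μ)
  weight-extension {n} {u} s R A μ w w̄ v =
    ≈-trans (*-cong (weight-ones {n} {u} {1} A) (weight-scale s μ R w w̄ v)) (*-identityˡ _)

  sumOverModels-cong : ∀ {s n} (Ψ : Sentence s n) {F G : World n s → Carrier} → (∀ μ → F μ ≈ G μ) →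
                       sumOverModels Rg s n Ψ F ≈ sumOverModels Rg s n Ψ G
  sumOverModels-cong {s} {n} Ψ F≈G = ∑-cong (allWorlds n s) (λ μ → if-cong (models s μ Ψ) (F≈G μ))

  sumOverModels-extension : ∀ {s n u} (Φ : Sentence (ExtSig u s) n) (Ψ : Sentence s n)
    (adm : World n s → World n (preds u 1) → Bool) →
    (∀ A μ → models (ExtSig u s) (A , μ) Φ ≡ models s μ Ψ ∧ adm μ A) →
    (F : World n (ExtSig u s) → Carrier) (G : World n s → Carrier) → (∀ A μ → F (A , μ) ≈ G μ) →
    sumOverModels Rg (ExtSig u s) n Φ F ≈
    sumOverModels Rg s n Ψ (λ μ → fromℕ Rg (countList (adm μ) (allWorlds n (preds u 1))) * G μ)
  sumOverModels-extension {s} {n} {u} Φ Ψ adm models-Φ F G F≈G = begin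
    sumOver (λ p → if models _ p Φ then F p else 0#) (cartesianProduct As Ms)
      ≈⟨ ∑-cartesianProduct _ As Ms ⟩
    ∑[ A ∈ As ] ∑[ μ ∈ Ms ] (if models _ (A , μ) Φ then F (A , μ) else 0#)
      ≈⟨ ∑-comm _ As Ms ⟩
    ∑[ μ ∈ Ms ] ∑[ A ∈ As ] (if models _ (A , μ) Φ then F (A , μ) else 0#)
      ≈⟨ ∑-cong Ms sum-A ⟩
    ∑[ μ ∈ Ms ] (if models s μ Ψ then fromℕ Rg (countList (adm μ) As) * G μ else 0#) ∎
    where
    As : List (World n (preds u 1))
    As = allWorlds n (preds u 1)
    Ms : List (World n s)
    Ms = allWorlds n s
    sum-A : ∀ μ → ∑[ A ∈ As ] (if models _ (A , μ) Φ then F (A , μ) else 0#) ≈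
                  (if models s μ Ψ then fromℕ Rg (countList (adm μ) As) * G μ else 0#)
    sum-A μ = ≈-trans (∑-cong As (λ A → ≈-trans (≈-reflexive (cong (if_then F (A , μ) else 0#) (models-Φ A μ)))
                                                 (if-cong (models s μ Ψ ∧ adm μ A) (F≈G A μ))))
                      (by-cases (models s μ Ψ))
      where
      by-cases : ∀ b → ∑[ A ∈ As ] (if b ∧ adm μ A then G μ else 0#) ≈
                       (if b then fromℕ Rg (countList (adm μ) As) * G μ else 0#)
      by-cases true  = ∑-if (adm μ) (G μ) As
      by-cases false = ∑-zero As

-- Counting

open import Data.Nat using (_+_; _*_; _^_)
open import Data.Nat.Properties using (+-*-commutativeSemiring; +-identityʳ; *-identityʳ; +-comm; ^-distribˡ-+-*)

iverson : Bool → ℕ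
iverson b = if b then 1 else 0

open ListSum +-*-commutativeSemiring

countList-∑ : ∀ {A : Set} (p : A → Bool) (xs : List A) → countList p xs ≡ ∑[ x ∈ xs ] iverson (p x)
countList-∑ p []       = refl
countList-∑ p (x ∷ xs) with p x
... | true  = cong suc (countList-∑ p xs)
... | false = countList-∑ p xs

countList-map : ∀ {A B : Set} (p : B → Bool) (f : A → B) (xs : List A) →
                countList p (map f xs) ≡ countList (p ∘ f) xs
countList-map p f []       = refl
countList-map p f (x ∷ xs) with p (f x)
... | true  = cong suc (countList-map p f xs)
... | false = countList-map p f xs

countList-cong : ∀ {A : Set} {p q : A → Bool} → (∀ x → p x ≡ q x) → ∀ xs → countList p xs ≡ countList q xs
countList-cong p≡q []       = refl
countList-cong p≡q (x ∷ xs) rewrite p≡q x | countList-cong p≡q xs = refl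

countList-tabulate : ∀ {A : Set} {n} (p : A → Bool) (f : Fin n → A) →
                     countList p (tabulate f) ≡ countList (p ∘ f) (allFin n)
countList-tabulate p f = trans (cong (countList p) (sym (map-tabulate (λ i → i) f))) (countList-map p f (allFin _))

countList-allFin-suc : ∀ {n} (p : Fin (suc n) → Bool) →
                       countList p (allFin (suc n)) ≡ iverson (p zero) + countList (p ∘ suc) (allFin n)
countList-allFin-suc p with p zero
... | true  = cong suc (countList-tabulate p suc)
... | false = countList-tabulate p suc

countList-allVecs-suc : ∀ {A : Set} {k} (p : Vec A (suc k) → Bool) (xs : List A) →
  countList p (allVecs xs (suc k)) ≡ ∑[ x ∈ xs ] countList (λ v → p (x ∷ v)) (allVecs xs k)
countList-allVecs-suc {k = k} p xs = trans (countList-∑ p (allVecs xs (suc k)))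
  (trans (∑-allVecs-suc (iverson ∘ p) xs) (∑-cong xs λ x → sym (countList-∑ (p ∘ (x ∷_)) (allVecs xs k))))

countList-∧ˡ : ∀ {A : Set} (b : Bool) (q : A → Bool) (xs : List A) →
               countList (λ x → b ∧ q x) xs ≡ iverson b * countList q xs
countList-∧ˡ true  q xs = sym (+-identityʳ _)
countList-∧ˡ false q []       = refl
countList-∧ˡ false q (x ∷ xs) = countList-∧ˡ false q xs

∑-iverson-* : ∀ {A : Set} (p : A → Bool) (f : A → ℕ) {N} → (∀ x → T (p x) → f x ≡ N) →
              (xs : List A) → ∑[ x ∈ xs ] (iverson (p x) * f x) ≡ countList p xs * N
∑-iverson-* p f f≡N []       = refl
∑-iverson-* p f f≡N (x ∷ xs) with p x in px
... | true  = cong₂ _+_ (trans (+-identityʳ (f x)) (f≡N x (subst T (sym px) _))) (∑-iverson-* p f f≡N xs)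
... | false = ∑-iverson-* p f f≡N xs

countList-≤-length : ∀ {A : Set} (p : A → Bool) xs → countList p xs ℕ.≤ length xs
countList-≤-length p []       = ℕ.z≤n
countList-≤-length p (x ∷ xs) with p x
... | true  = ℕ.s≤s (countList-≤-length p xs)
... | false = ℕ.m≤n⇒m≤1+n (countList-≤-length p xs)

countList-mono : ∀ {A : Set} {p q : A → Bool} → (∀ x → T (p x) → T (q x)) →
                 ∀ xs → countList p xs ℕ.≤ countList q xs
countList-mono p⇒q [] = ℕ.z≤n
countList-mono {p = p} {q} p⇒q (x ∷ xs) with p x | q x | p⇒q x
... | true  | true  | _ = ℕ.s≤s (countList-mono p⇒q xs)
... | true  | false | h = contradiction _ h
... | false | true  | _ = ℕ.m≤n⇒m≤1+n (countList-mono p⇒q xs)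
... | false | false | _ = countList-mono p⇒q xs

countList-< : ∀ {A : Set} {p q : A → Bool} → (∀ x → T (p x) → T (q x)) →
              ∀ {x xs} → x ∈ xs → ¬ T (p x) → T (q x) → countList p xs ℕ.< countList q xs
countList-< {p = p} {q} p⇒q {xs = y ∷ ys} (here refl) ¬py qy with p y | q y
... | true  | _    = contradiction _ ¬py
... | false | true = ℕ.s≤s (countList-mono p⇒q ys)
countList-< {p = p} {q} p⇒q {xs = y ∷ ys} (there x∈ys) ¬px qx with p y | q y | p⇒q y
... | true  | true  | _ = ℕ.s≤s (countList-< p⇒q x∈ys ¬px qx)
... | true  | false | h = contradiction _ h
... | false | true  | _ = ℕ.m<n⇒m<1+n (countList-< p⇒q x∈ys ¬px qx)
... | false | false | _ = countList-< p⇒q x∈ys ¬px qx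

Enumerates : ∀ {X : Set} → DecidableEquality X → List X → Set
Enumerates _≟_ xs = ∀ e → countList (λ x → ⌊ x ≟ e ⌋) xs ≡ 1

allVecs-enumerates : ∀ {X : Set} (_≟_ : DecidableEquality X) {xs} → Enumerates _≟_ xs →
                     ∀ k → Enumerates (≡-dec _≟_) (allVecs xs k)
allVecs-enumerates _≟_ xs-enum zero    []       = refl
allVecs-enumerates _≟_ {xs} xs-enum (suc k) (e ∷ es) = begin
  countList (λ v → ⌊ ≡-dec _≟_ v (e ∷ es) ⌋) (allVecs xs (suc k))
    ≡⟨ countList-allVecs-suc _ xs ⟩
  ∑[ x ∈ xs ] countList (λ v → ⌊ ≡-dec _≟_ (x ∷ v) (e ∷ es) ⌋) (allVecs xs k)
    ≡⟨ ∑-cong xs (λ x → countList-cong (λ v → ≡-dec-∷ _≟_ x e v es) (allVecs xs k)) ⟩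
  ∑[ x ∈ xs ] countList (λ v → ⌊ x ≟ e ⌋ ∧ ⌊ ≡-dec _≟_ v es ⌋) (allVecs xs k)
    ≡⟨ ∑-cong xs (λ x → countList-∧ˡ ⌊ x ≟ e ⌋ _ (allVecs xs k)) ⟩
  ∑[ x ∈ xs ] (iverson ⌊ x ≟ e ⌋ * countList (λ v → ⌊ ≡-dec _≟_ v es ⌋) (allVecs xs k))
    ≡⟨ ∑-iverson-* _ _ (λ _ _ → allVecs-enumerates _≟_ xs-enum k es) xs ⟩
  countList (λ x → ⌊ x ≟ e ⌋) xs * 1
    ≡⟨ cong (_* 1) (xs-enum e) ⟩
  1 ∎
  where open ≡-Reasoning

bools : List Bool
bools = true ∷ false ∷ []

bools-enumerates : Enumerates Bool._≟_ bools
bools-enumerates true  = refl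
bools-enumerates false = refl

descending : ∀ {u} → Vec Bool u → Bool
descending []           = true
descending (b ∷ [])     = true
descending (b ∷ b′ ∷ v) = (b′ ⇒b b) ∧ descending (b′ ∷ v)

chainAt : ∀ {u} → Vec Bool u → Fin u → Bool
chainAt v zero    = true
chainAt v (suc j) = lookup v (suc j) ⇒b lookup v (inject₁ j)

all-chainAt : ∀ {u} (v : Vec Bool u) → all (chainAt v) (allFin u) ≡ descending v
all-chainAt []           = refl
all-chainAt (b ∷ [])     = refl
all-chainAt (b ∷ b′ ∷ v) =
  trans (all-allFin-suc (chainAt (b ∷ b′ ∷ v))) (trans (all-allFin-suc (chainAt (b ∷ b′ ∷ v) ∘ suc))
    (cong ((b′ ⇒b b) ∧_) (trans (sym (all-allFin-suc (chainAt (b′ ∷ v)))) (all-chainAt (b′ ∷ v)))))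

descending-true∷ : ∀ {u} (v : Vec Bool u) → descending (true ∷ v) ≡ descending v
descending-true∷ []          = refl
descending-true∷ (true ∷ v)  = refl
descending-true∷ (false ∷ v) = refl

descending-false∷ : ∀ {u} (v : Vec Bool u) → descending (false ∷ v) ≡ ⌊ ≡-dec Bool._≟_ v (replicate u false) ⌋
descending-false∷ []          = refl
descending-false∷ {suc u} (true ∷ v)  = sym (≡-dec-∷ Bool._≟_ true false v (replicate u false))
descending-false∷ {suc u} (false ∷ v) =
  trans (descending-false∷ v) (sym (≡-dec-∷ Bool._≟_ false false v (replicate u false)))

count-descending : ∀ u → countList descending (allVecs bools u) ≡ suc u
count-descending zero    = refl
count-descending (suc u) = begin
  countList descending (allVecs bools (suc u))
    ≡⟨ countList-allVecs-suc {k = u} descending bools ⟩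
  countList (descending ∘ (true ∷_)) (allVecs bools u) + (countList (descending ∘ (false ∷_)) (allVecs bools u) + 0)
    ≡⟨ cong₂ (λ x y → x + (y + 0)) (trans (countList-cong descending-true∷ (allVecs bools u)) (count-descending u))
                                   (trans (countList-cong descending-false∷ (allVecs bools u))
                                          (allVecs-enumerates Bool._≟_ bools-enumerates u (replicate u false))) ⟩
  suc u + 1
    ≡⟨ +-comm (suc u) 1 ⟩
  suc (suc u) ∎
  where open ≡-Reasoning

module Colourings {X : Set} (_≟_ : DecidableEquality X) (D : List X) (D-enum : Enumerates _≟_ D)
                  (ok : X → Bool) where

  data Constraint (k : ℕ) : Set where
    free  : Constraint k
    fixed : X → Constraint k
    same  : Fin k → Constraint k

  isFree : ∀ {k} → Constraint k → Bool
  isFree free      = true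
  isFree (fixed _) = false
  isFree (same _)  = false

  meets : ∀ {k} → Vec X k → Fin k → Constraint k → Bool
  meets C a free      = true
  meets C a (fixed e) = ⌊ lookup C a ≟ e ⌋
  meets C a (same b)  = ⌊ lookup C a ≟ lookup C b ⌋

  Proper : ∀ {k} → Fin k → Constraint k → Set
  Proper a free      = ⊤
  Proper a (fixed e) = T (ok e)
  Proper a (same b)  = b < a

  Valid : ∀ {k} → (Fin k → Constraint k) → Vec X k → Bool
  Valid t C = all (λ a → ok (lookup C a) ∧ meets C a (t a)) (allFin _)

  -- the constraint left on the remaining vertices once vertex zero has colour c
  instantiate₀ : ∀ {k} → X → Constraint (suc k) → Constraint k
  instantiate₀ c free           = free
  instantiate₀ c (fixed e)      = fixed e
  instantiate₀ c (same zero)    = fixed c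
  instantiate₀ c (same (suc b)) = same b

  meets-suc : ∀ {k} c (C : Vec X k) a τ → meets (c ∷ C) (suc a) τ ≡ meets C a (instantiate₀ c τ)
  meets-suc c C a free           = refl
  meets-suc c C a (fixed e)      = refl
  meets-suc c C a (same zero)    = refl
  meets-suc c C a (same (suc b)) = refl

  Proper-instantiate₀ : ∀ {k} {c} {a : Fin k} τ → T (ok c) → Proper (suc a) τ → Proper a (instantiate₀ c τ)
  Proper-instantiate₀ free           _  _        = _
  Proper-instantiate₀ (fixed e)      _  ok-e     = ok-e
  Proper-instantiate₀ (same zero)    ok-c _      = ok-c
  Proper-instantiate₀ (same (suc b)) _  (s≤s b<a) = b<a

  isFree-instantiate₀ : ∀ {k} c (τ : Constraint (suc k)) → isFree (instantiate₀ c τ) ≡ isFree τ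
  isFree-instantiate₀ c free           = refl
  isFree-instantiate₀ c (fixed e)      = refl
  isFree-instantiate₀ c (same zero)    = refl
  isFree-instantiate₀ c (same (suc b)) = refl

  meets₀ : ∀ {k} → X → Constraint (suc k) → Bool
  meets₀ c free      = true
  meets₀ c (fixed e) = ⌊ c ≟ e ⌋
  meets₀ c (same _)  = false

  meets-zero : ∀ {k} c (C : Vec X k) τ → Proper zero τ → meets (c ∷ C) zero τ ≡ meets₀ c τ
  meets-zero c C free      _ = refl
  meets-zero c C (fixed e) _ = refl

  Valid-∷ : ∀ {k} (t : Fin (suc k) → Constraint (suc k)) → Proper zero (t zero) → ∀ c C →
            Valid t (c ∷ C) ≡ (ok c ∧ meets₀ c (t zero)) ∧ Valid (instantiate₀ c ∘ t ∘ suc) C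
  Valid-∷ t proper₀ c C = trans (all-allFin-suc (λ a → ok (lookup (c ∷ C) a) ∧ meets (c ∷ C) a (t a))) (cong₂ _∧_
    (cong (ok c ∧_) (meets-zero c C (t zero) proper₀))
    (all-cong (λ a → cong (ok (lookup C a) ∧_) (meets-suc c C a (t (suc a)))) (allFin _)))

  count-meets₀ : ∀ {k} (τ : Constraint (suc k)) → Proper zero τ →
                 countList (λ c → ok c ∧ meets₀ c τ) D ≡ countList ok D ^ iverson (isFree τ)
  count-meets₀ free      _    = trans (countList-cong (λ c → ∧-identityʳ (ok c)) D) (sym (*-identityʳ _))
  count-meets₀ (fixed e) ok-e = trans (countList-cong ok∧≟e D) (D-enum e)
    where
    ok∧≟e : ∀ c → ok c ∧ ⌊ c ≟ e ⌋ ≡ ⌊ c ≟ e ⌋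
    ok∧≟e c with c ≟ e
    ... | yes refl = cong (_∧ true) (Equivalence.to T-≡ ok-e)
    ... | no _     = ∧-zeroʳ (ok c)

  count-Valid : ∀ {k} (t : Fin k → Constraint k) → (∀ a → Proper a (t a)) →
                countList (Valid t) (allVecs D k) ≡ countList ok D ^ countList (isFree ∘ t) (allFin k)
  count-Valid {zero}  t proper = refl
  count-Valid {suc k} t proper = begin
    countList (Valid t) (allVecs D (suc k))
      ≡⟨ countList-allVecs-suc (Valid t) D ⟩
    ∑[ c ∈ D ] countList (λ C → Valid t (c ∷ C)) (allVecs D k)
      ≡⟨ ∑-cong D (λ c → countList-cong (Valid-∷ t (proper zero) c) (allVecs D k)) ⟩
    ∑[ c ∈ D ] countList (λ C → head c ∧ Valid (rest c) C) (allVecs D k)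
      ≡⟨ ∑-cong D (λ c → countList-∧ˡ (head c) _ (allVecs D k)) ⟩
    ∑[ c ∈ D ] (iverson (head c) * countList (Valid (rest c)) (allVecs D k))
      ≡⟨ ∑-iverson-* head _ count-rest D ⟩
    countList head D * m ^ K
      ≡⟨ cong (_* m ^ K) (count-meets₀ (t zero) (proper zero)) ⟩
    m ^ iverson (isFree (t zero)) * m ^ K
      ≡⟨ sym (^-distribˡ-+-* m (iverson (isFree (t zero))) K) ⟩
    m ^ (iverson (isFree (t zero)) + K)
      ≡⟨ cong (m ^_) (sym (countList-allFin-suc (isFree ∘ t))) ⟩
    m ^ countList (isFree ∘ t) (allFin (suc k)) ∎
    where
    open ≡-Reasoning
    m K : ℕ
    m = countList ok D
    K = countList (isFree ∘ t ∘ suc) (allFin k)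
    head : X → Bool
    head c = ok c ∧ meets₀ c (t zero)
    rest : X → Fin k → Constraint k
    rest c = instantiate₀ c ∘ t ∘ suc
    count-rest : ∀ c → T (head c) → countList (Valid (rest c)) (allVecs D k) ≡ m ^ K
    count-rest c head-c = trans
      (count-Valid (rest c) (λ a → Proper-instantiate₀ (t (suc a)) ok-c (proper (suc a))))
      (cong (m ^_) (countList-cong (λ a → isFree-instantiate₀ c (t (suc a))) (allFin k)))
      where
      ok-c : T (ok c)
      ok-c = proj₁ (Equivalence.to (T-∧ {ok c}) head-c)

  count-colourings-constant-along : ∀ {k} (r : Fin k → Fin k) → (∀ a → r a ≤ a) →
    countList (λ C → all (λ a → ok (lookup C a) ∧ ⌊ lookup C a ≟ lookup C (r a) ⌋) (allFin k)) (allVecs D k)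
      ≡ countList ok D ^ countList (λ a → ⌊ r a ≟ᶠ a ⌋) (allFin k)
  count-colourings-constant-along {k} r r≤ = begin
    countList (λ C → all (λ a → ok (lookup C a) ∧ ⌊ lookup C a ≟ lookup C (r a) ⌋) (allFin k)) (allVecs D k)
      ≡⟨ countList-cong (λ C → all-cong (λ a → cong (ok (lookup C a) ∧_) (meets-pointer C a (r a ≟ᶠ a)))
                                        (allFin k))
                        (allVecs D k) ⟩
    countList (Valid t) (allVecs D k)
      ≡⟨ count-Valid t (λ a → Proper-pointer a (r a ≟ᶠ a)) ⟩
    countList ok D ^ countList (isFree ∘ t) (allFin k)
      ≡⟨ cong (countList ok D ^_) (countList-cong (λ a → isFree-pointer a (r a ≟ᶠ a)) (allFin k)) ⟩
    countList ok D ^ countList (λ a → ⌊ r a ≟ᶠ a ⌋) (allFin k) ∎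
    where
    open ≡-Reasoning
    pointer : (a b : Fin k) → Dec (b ≡ a) → Constraint k
    pointer a b (yes _) = free
    pointer a b (no _)  = same b
    t : Fin k → Constraint k
    t a = pointer a (r a) (r a ≟ᶠ a)
    meets-pointer : ∀ C a (d : Dec (r a ≡ a)) → ⌊ lookup C a ≟ lookup C (r a) ⌋ ≡ meets C a (pointer a (r a) d)
    meets-pointer C a (yes ra≡a) rewrite ra≡a = cong ⌊_⌋ (≡-≟-identity _≟_ refl)
    meets-pointer C a (no _)     = refl
    Proper-pointer : ∀ a (d : Dec (r a ≡ a)) → Proper a (pointer a (r a) d)
    Proper-pointer a (yes _)    = _
    Proper-pointer a (no ra≢a) = ≤∧≢⇒< (r≤ a) ra≢a
    isFree-pointer : ∀ a (d : Dec (r a ≡ a)) → isFree (pointer a (r a) d) ≡ ⌊ d ⌋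
    isFree-pointer a (yes _) = refl
    isFree-pointer a (no _)  = refl

-- Connected components

least : ∀ {n} (P : Fin n → Set) → Decidable P → ∀ {i} → P i → ∃ λ m → P m × (∀ j → j < m → ¬ P j)
least P P? {i} Pi with ¬∀⟶∃¬-smallest _ (¬_ ∘ P) (¬? ∘ P?) (λ ∀¬P → ∀¬P i Pi)
... | m , ¬¬Pm , below = m , decidable-stable (P? m) ¬¬Pm , λ j j<m →
  subst (¬_ ∘ P) (toℕ-injective (trans (toℕ-inject (fromℕ< j<m)) (toℕ-fromℕ< j<m))) (below (fromℕ< j<m))

module Connectivity {n} (s : Sig) (R : Pred s) (r2 : arity s R ≡ 2) (μ : World n s) where

  E : Fin n → Fin n → Bool
  E = adj s R r2 μ

  reach : ℕ → Fin n → Fin n → Bool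
  reach = reachWithin s R r2 μ

  conn : Fin n → Fin n → Bool
  conn = connected s R r2 μ

  E-sym : ∀ a b → E a b ≡ E b a
  E-sym a b = ∨-comm (Rholds s R r2 μ a b) _

  -- walks of length at most k
  data Walk (a : Fin n) : ℕ → Fin n → Set where
    []  : ∀ {k} → Walk a k a
    _▷_ : ∀ {k c b} → Walk a k c → T (E c b) → Walk a (suc k) b

  weaken : ∀ {a k b} → Walk a k b → Walk a (suc k) b
  weaken []      = []
  weaken (w ▷ e) = weaken w ▷ e

  reach⇔Walk : ∀ k {a b} → T (reach k a b) ⇔ Walk a k b
  reach⇔Walk zero    = mk⇔ (λ h → subst (Walk _ 0) (toWitness h) []) (λ { [] → fromWitness refl })
  reach⇔Walk (suc k) {a} {b} = mk⇔ to from
    where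
    to : T (reach (suc k) a b) → Walk a (suc k) b
    to h with Equivalence.to (T-∨ {reach k a b}) h
    ... | inj₁ h′ = weaken (Equivalence.to (reach⇔Walk k) h′)
    ... | inj₂ h′ with Equivalence.to (T-any-allFin _) h′
    ...   | c , h″ with Equivalence.to (T-∧ {reach k a c}) h″
    ...     | h‴ , e = Equivalence.to (reach⇔Walk k) h‴ ▷ e
    from : Walk a (suc k) b → T (reach (suc k) a b)
    from []      = Equivalence.from T-∨ (inj₁ (Equivalence.from (reach⇔Walk k) []))
    from (w ▷ e) = Equivalence.from (T-∨ {reach k a b})
      (inj₂ (Equivalence.from (T-any-allFin (λ c → reach k a c ∧ E c b))
                (_ , Equivalence.from T-∧ (Equivalence.from (reach⇔Walk k) w , e))))

  Walk-mono : ∀ {a k m b} → k ℕ.≤ m → Walk a k b → Walk a m b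
  Walk-mono k≤m = go (ℕ.≤⇒≤′ k≤m)
    where
    go : ∀ {a k m b} → k ℕ.≤′ m → Walk a k b → Walk a m b
    go ℕ.≤′-refl       w = w
    go (ℕ.≤′-step k≤m) w = weaken (go k≤m w)

  _++ᵂ_ : ∀ {a b c j k} → Walk a j b → Walk b k c → Walk a (k + j) c
  _++ᵂ_ {j = j} {k} w [] = Walk-mono (ℕ.m≤n+m j k) w
  w ++ᵂ (w′ ▷ e)         = (w ++ᵂ w′) ▷ e

  _◁_ : ∀ {a c k b} → T (E a c) → Walk c k b → Walk a (suc k) b
  e ◁ []      = [] ▷ e
  e ◁ (w ▷ f) = (e ◁ w) ▷ f

  reverse : ∀ {a k b} → Walk a k b → Walk b k a
  reverse []      = []
  reverse (w ▷ e) = subst T (E-sym _ _) e ◁ reverse w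

  Walk-respects : ∀ {X : Set} (f : Fin n → X) → (∀ a b → T (E a b) → f a ≡ f b) →
                  ∀ {a k b} → Walk a k b → f a ≡ f b
  Walk-respects f f-E []      = refl
  Walk-respects f f-E (w ▷ e) = trans (Walk-respects f f-E w) (f-E _ _ e)

  Stable : Fin n → ℕ → Set
  Stable a j = ∀ {b} → Walk a (suc j) b → Walk a j b

  Stable-bound : ∀ {a j} → Stable a j → ∀ {m b} → Walk a m b → Walk a j b
  Stable-bound stable []      = []
  Stable-bound stable (w ▷ e) = stable (Stable-bound stable w ▷ e)

  -- the number of vertices within distance k of a grows strictly until it stabilises
  stabilises-or-grows : ∀ a k → (∃ λ j → j ℕ.≤ k × Stable a j) ⊎ suc k ℕ.≤ countList (reach k a) (allFin n)
  stabilises-or-grows a zero = inj₂ (ℕ.≤-trans (ℕ.s≤s ℕ.z≤n)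
    (countList-< {p = λ _ → false} (λ _ ()) (∈-allFin a) (λ ()) (Equivalence.from (reach⇔Walk 0) [])))
  stabilises-or-grows a (suc k) with stabilises-or-grows a k
  ... | inj₁ (j , j≤k , stable) = inj₁ (j , ℕ.m≤n⇒m≤1+n j≤k , stable)
  ... | inj₂ grown with all? (λ b → T? (reach (suc k) a b) →-dec T? (reach k a b))
  ...   | yes shrink = inj₁ (k , ℕ.n≤1+n k , λ w →
          Equivalence.to (reach⇔Walk k) (shrink _ (Equivalence.from (reach⇔Walk (suc k)) w)))
  ...   | no ¬shrink with ¬∀⟶∃¬ n _ (λ b → T? (reach (suc k) a b) →-dec T? (reach k a b)) ¬shrink
  ...     | b , ¬shrink-b with ¬[T→T] ¬shrink-b
  ...       | new , ¬old = inj₂ (ℕ.≤-trans (ℕ.s≤s grown) (countList-<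
                (λ c old → Equivalence.from (reach⇔Walk (suc k)) (weaken (Equivalence.to (reach⇔Walk k) old)))
                (∈-allFin b) ¬old new))

  Walk-bound : ∀ {a m b} → Walk a m b → Walk a n b
  Walk-bound {a} w with stabilises-or-grows a n
  ... | inj₁ (j , j≤n , stable) = Walk-mono j≤n (Stable-bound stable w)
  ... | inj₂ grown = contradiction
    (ℕ.≤-trans grown (ℕ.≤-trans (countList-≤-length _ (allFin n)) (ℕ.≤-reflexive (length-tabulate _))))
    ℕ.1+n≰n

  conn-refl : ∀ a → T (conn a a)
  conn-refl a = Equivalence.from (reach⇔Walk n) []

  conn-sym : ∀ {a b} → T (conn a b) → T (conn b a)
  conn-sym = Equivalence.from (reach⇔Walk n) ∘ reverse ∘ Equivalence.to (reach⇔Walk n)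

  conn-trans : ∀ {a b c} → T (conn a b) → T (conn b c) → T (conn a c)
  conn-trans h h′ = Equivalence.from (reach⇔Walk n)
    (Walk-bound (Equivalence.to (reach⇔Walk n) h ++ᵂ Equivalence.to (reach⇔Walk n) h′))

  E⇒conn : ∀ {a b} → T (E a b) → T (conn a b)
  E⇒conn e = Equivalence.from (reach⇔Walk n) (Walk-bound ([] {k = 0} ▷ e))

  rep : Fin n → Fin n
  rep a = proj₁ (least (T ∘ conn a) (T? ∘ conn a) (conn-refl a))

  conn-rep : ∀ a → T (conn a (rep a))
  conn-rep a = proj₁ (proj₂ (least (T ∘ conn a) (T? ∘ conn a) (conn-refl a)))

  rep-minimal : ∀ {a b} → b < rep a → ¬ T (conn a b)
  rep-minimal {a} = proj₂ (proj₂ (least (T ∘ conn a) (T? ∘ conn a) (conn-refl a))) _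

  rep-≤ : ∀ a → rep a ≤ a
  rep-≤ a = ℕ.≮⇒≥ (λ a<rep → rep-minimal a<rep (conn-refl a))

  rep-cong : ∀ {a b} → T (conn a b) → rep a ≡ rep b
  rep-cong {a} {b} h with <-cmp (rep a) (rep b)
  ... | tri< ra<rb _ _ = contradiction (conn-trans (conn-sym h) (conn-rep a)) (rep-minimal ra<rb)
  ... | tri≈ _ ra≡rb _ = ra≡rb
  ... | tri> _ _ rb<ra = contradiction (conn-trans h (conn-rep b)) (rep-minimal rb<ra)

  cc≡#fixed-rep : cc s R r2 μ ≡ countList (λ a → ⌊ rep a ≟ᶠ a ⌋) (allFin n)
  cc≡#fixed-rep = countList-cong (λ a → T-ext (to a) (from a)) (allFin n)
    where
    earlier : Fin n → Bool
    earlier a = any (λ b → ⌊ b <? a ⌋ ∧ conn a b) (allFin n)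
    to : ∀ a → T (not (earlier a)) → T ⌊ rep a ≟ᶠ a ⌋
    to a none with rep a ≟ᶠ a
    ... | yes _    = _
    ... | no ra≢a = Equivalence.to T-not none (Equivalence.from (T-any-allFin _)
          (rep a , Equivalence.from T-∧ (fromWitness (≤∧≢⇒< (rep-≤ a) ra≢a) , conn-rep a)))
    from : ∀ a → T ⌊ rep a ≟ᶠ a ⌋ → T (not (earlier a))
    from a ra≡a = Equivalence.from T-not λ h → case Equivalence.to (T-any-allFin _) h of λ
      { (b , h′) → case Equivalence.to (T-∧ {⌊ b <? a ⌋}) h′ of λ
        { (b<a , ab) → rep-minimal (subst (b <_) (sym (toWitness ra≡a)) (toWitness b<a)) ab } }

  edge-invariant⇔rep-invariant : ∀ {X : Set} (f : Fin n → X) →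
    (∀ a b → T (E a b) → f a ≡ f b) ⇔ (∀ a → f a ≡ f (rep a))
  edge-invariant⇔rep-invariant f = mk⇔
    (λ f-E a → Walk-respects f f-E (Equivalence.to (reach⇔Walk n) (conn-rep a)))
    (λ f-rep a b e → trans (f-rep a) (trans (cong f (rep-cong (E⇒conn e))) (sym (f-rep b))))

-- The extension by A_1, …, A_u

sat-liftF : ∀ {u n m} (s : Sig) (A : World n (preds u 1)) (μ : World n s) (φ : Formula s n m) ρ →
            sat (ExtSig u s) (A , μ) (liftF s φ) ρ ≡ sat s μ φ ρ
sat-liftF s A μ (atom p ts)  ρ = refl
sat-liftF s A μ (equal t t′) ρ = refl
sat-liftF s A μ (card p o k) ρ = refl
sat-liftF s A μ ⊤f           ρ = refl
sat-liftF s A μ ⊥f           ρ = refl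
sat-liftF s A μ (¬f φ)       ρ = cong not (sat-liftF s A μ φ ρ)
sat-liftF s A μ (φ ∧f ψ)     ρ = cong₂ _∧_ (sat-liftF s A μ φ ρ) (sat-liftF s A μ ψ ρ)
sat-liftF s A μ (φ ∨f ψ)     ρ = cong₂ _∨_ (sat-liftF s A μ φ ρ) (sat-liftF s A μ ψ ρ)
sat-liftF s A μ (φ ⇒f ψ)     ρ = cong₂ _⇒b_ (sat-liftF s A μ φ ρ) (sat-liftF s A μ ψ ρ)
sat-liftF s A μ (φ ⇔f ψ)     ρ = cong₂ _⇔b_ (sat-liftF s A μ φ ρ) (sat-liftF s A μ ψ ρ)
sat-liftF s A μ (∀f φ)       ρ = all-cong (λ a → sat-liftF s A μ φ (extend a ρ)) (allFin _)
sat-liftF s A μ (∃f φ)       ρ = cong or (map-cong (λ a → sat-liftF s A μ φ (extend a ρ)) (allFin _))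

sat-bigAnd : ∀ {s n m} (μ : World n s) (φs : List (Formula s n m)) ρ →
             sat s μ (bigAnd φs) ρ ≡ all (λ φ → sat s μ φ ρ) φs
sat-bigAnd μ []       ρ = refl
sat-bigAnd μ (φ ∷ φs) ρ = cong (sat _ μ φ ρ ∧_) (sat-bigAnd μ φs ρ)

T-sat-bigAnd-allFin : ∀ {s n m k} (μ : World n s) (φ : Fin k → Formula s n m) ρ →
                      T (sat s μ (bigAnd (map φ (allFin k))) ρ) ⇔ (∀ i → T (sat s μ (φ i) ρ))
T-sat-bigAnd-allFin μ φ ρ rewrite sat-bigAnd μ (map φ (allFin _)) ρ | all-map (λ ψ → sat _ μ ψ ρ) φ (allFin _) =
  T-all-allFin _

sat-Ratom : ∀ {n m} (s : Sig) (R : Pred s) (r2 : arity s R ≡ 2) (μ : World n s) (x y : Term n m) ρ →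
            sat s μ (Ratom s R r2 x y) ρ ≡ Rholds s R r2 μ (evalTerm ρ x) (evalTerm ρ y)
sat-Ratom s R r2 μ x y ρ = cong (holds s μ R) (evalTerms-subst (sym r2))
  where
  evalTerms-subst : ∀ {k} (eq : 2 ≡ k) →
    evalTerms ρ (subst (Vec (Term _ _)) eq (x ∷ y ∷ [])) ≡ subst (Vec (Fin _)) eq (evalTerm ρ x ∷ evalTerm ρ y ∷ [])
  evalTerms-subst refl = refl

module Extension (u : ℕ) {n} (s : Sig) (R : Pred s) (r2 : arity s R ≡ 2) (μ : World n s) where
  open Connectivity s R r2 μ

  axioms : Sentence (ExtSig u s) n
  axioms = bigAnd (map (closureAx s R r2) (allFin u)) ∧f bigAnd (map (chainAx s) (allFin u))

  admissible : World n (preds u 1) → Bool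
  admissible A = models (ExtSig u s) (A , μ) axioms

  models-PsiRu : ∀ A Ψ → models (ExtSig u s) (A , μ) (PsiRu s R r2 u Ψ) ≡ models s μ Ψ ∧ admissible A
  models-PsiRu A Ψ = cong (_∧ admissible A) (sat-liftF s A μ Ψ noEnv)

  columns : Vec (Vec Bool u) n → World n (preds u 1)
  columns C = transpose (widen C)

  holds-columns : ∀ C i a → holds (preds u 1) (columns C) i (a ∷ []) ≡ lookup (lookup C a) i
  holds-columns C i a = trans (lookup-transpose (widen C) i (combine a zero)) (cong (λ v → lookup v i) (lookup-widen C a))

  sat-closureAx : ∀ C i → sat (ExtSig u s) (columns C , μ) (closureAx s R r2 i) noEnv ≡
                  all (λ a → all (λ b → (lookup (lookup C a) i ∧ E a b) ⇒b lookup (lookup C b) i) (allFin n)) (allFin n)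
  sat-closureAx C i = all-cong (λ a → all-cong (λ b → cong₂ _⇒b_
      (cong₂ _∧_ (holds-columns C i a) (cong₂ _∨_ (sat-R x y (ρ a b)) (sat-R y x (ρ a b))))
      (holds-columns C i b)) (allFin n)) (allFin n)
    where
    x y : Term n 2
    x = var (suc zero)
    y = var zero
    ρ : Fin n → Fin n → Fin 2 → Fin n
    ρ a b = extend b (extend a noEnv)
    sat-R : ∀ t t′ ρ → sat (ExtSig u s) (columns C , μ) (Ratom (ExtSig u s) (inj₂ R) r2 t t′) ρ ≡
                       Rholds s R r2 μ (evalTerm ρ t) (evalTerm ρ t′)
    sat-R = sat-Ratom (ExtSig u s) (inj₂ R) r2 (columns C , μ)

  T-closureAx : ∀ C i → T (sat (ExtSig u s) (columns C , μ) (closureAx s R r2 i) noEnv) ⇔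
                        (∀ a b → T (E a b) → T (lookup (lookup C a) i) → T (lookup (lookup C b) i))
  T-closureAx C i rewrite sat-closureAx C i = mk⇔
    (λ h a b e ca → Equivalence.to T-⇒b (Equivalence.to (T-all-allFin _) (Equivalence.to (T-all-allFin _) h a) b)
                                        (Equivalence.from T-∧ (ca , e)))
    (λ h → Equivalence.from (T-all-allFin _) λ a → Equivalence.from (T-all-allFin _) λ b →
       Equivalence.from T-⇒b λ ca∧e → let (ca , e) = Equivalence.to (T-∧ {lookup (lookup C a) i}) ca∧e in h a b e ca)

  T-chainAx : ∀ C i → T (sat (ExtSig u s) (columns C , μ) (chainAx s i) noEnv) ⇔ (∀ a → T (chainAt (lookup C a) i))
  T-chainAx C zero    = mk⇔ (λ _ _ → _) (λ _ → _)
  T-chainAx C (suc j) = subst (λ x → T x ⇔ (∀ a → T (chainAt (lookup C a) (suc j))))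
    (sym (all-cong (λ a → cong₂ _⇒b_ (holds-columns C (suc j) a) (holds-columns C (inject₁ j) a)) (allFin n)))
    (T-all-allFin (λ a → chainAt (lookup C a) (suc j)))

  ComponentwiseDescending : Vec (Vec Bool u) n → Set
  ComponentwiseDescending C = ∀ a → T (descending (lookup C a)) × lookup C a ≡ lookup C (rep a)

  T-admissible-columns : ∀ C → T (admissible (columns C)) ⇔ ComponentwiseDescending C
  T-admissible-columns C = mk⇔ to from
    where
    closures : T (sat _ (columns C , μ) (bigAnd (map (closureAx s R r2) (allFin u))) noEnv) ⇔
               (∀ i → T (sat _ (columns C , μ) (closureAx s R r2 i) noEnv))
    closures = T-sat-bigAnd-allFin (columns C , μ) (closureAx s R r2) noEnv
    chains : T (sat _ (columns C , μ) (bigAnd (map (chainAx s) (allFin u))) noEnv) ⇔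
             (∀ i → T (sat _ (columns C , μ) (chainAx s i) noEnv))
    chains = T-sat-bigAnd-allFin (columns C , μ) (chainAx s) noEnv
    to : T (admissible (columns C)) → ComponentwiseDescending C
    to h a = subst T (all-chainAt (lookup C a)) (Equivalence.from (T-all-allFin _) λ i → nested i a)
           , Equivalence.to (edge-invariant⇔rep-invariant (lookup C)) edge a
      where
      closed : ∀ i a b → T (E a b) → T (lookup (lookup C a) i) → T (lookup (lookup C b) i)
      closed i = Equivalence.to (T-closureAx C i) (Equivalence.to closures (proj₁ (Equivalence.to T-∧ h)) i)
      nested : ∀ i a → T (chainAt (lookup C a) i)
      nested i = Equivalence.to (T-chainAx C i) (Equivalence.to chains (proj₂ (Equivalence.to T-∧ h)) i)
      edge : ∀ a b → T (E a b) → lookup C a ≡ lookup C b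
      edge a b e = lookup-ext λ i → T-ext (closed i a b e) (closed i b a (subst T (E-sym a b) e))
    from : ComponentwiseDescending C → T (admissible (columns C))
    from h = Equivalence.from T-∧
      ( Equivalence.from closures (λ i → Equivalence.from (T-closureAx C i) λ a b e →
          subst (λ v → T (lookup v i)) (edge a b e))
      , Equivalence.from chains (λ i → Equivalence.from (T-chainAx C i) λ a →
          Equivalence.to (T-all-allFin _) (subst T (sym (all-chainAt (lookup C a))) (proj₁ (h a))) i))
      where
      edge : ∀ a b → T (E a b) → lookup C a ≡ lookup C b
      edge = Equivalence.from (edge-invariant⇔rep-invariant (lookup C)) (proj₂ ∘ h)

  _≟ᶜ_ : DecidableEquality (Vec Bool u)
  _≟ᶜ_ = ≡-dec Bool._≟_

  admissible-columns : ∀ C → admissible (columns C) ≡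
    all (λ a → descending (lookup C a) ∧ ⌊ lookup C a ≟ᶜ lookup C (rep a) ⌋) (allFin n)
  admissible-columns C = T-ext
    (λ h → Equivalence.from (T-all-allFin _) λ a →
      let (desc , ≡rep) = Equivalence.to (T-admissible-columns C) h a in Equivalence.from T-∧ (desc , fromWitness ≡rep))
    (λ h → Equivalence.from (T-admissible-columns C) λ a →
      let (desc , ≡rep) = Equivalence.to T-∧ (Equivalence.to (T-all-allFin _) h a) in desc , toWitness ≡rep)

  count-admissible : countList admissible (allWorlds n (preds u 1)) ≡ suc u ^ cc s R r2 μ
  count-admissible = begin
    countList admissible (allVecs (allVecs bools (n ℕ.* 1)) u)
      ≡⟨ countList-∑ admissible (allVecs (allVecs bools (n ℕ.* 1)) u) ⟩
    ∑[ A ∈ allVecs (allVecs bools (n ℕ.* 1)) u ] iverson (admissible A)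
      ≡⟨ ∑-transpose {u = u} {k = n ℕ.* 1} (iverson ∘ admissible) bools ⟩
    ∑[ C ∈ allVecs colours (n ℕ.* 1) ] iverson (admissible (transpose C))
      ≡⟨ ∑-widen {k = n} (iverson ∘ admissible ∘ transpose) colours ⟩
    ∑[ C ∈ allVecs colours n ] iverson (admissible (columns C))
      ≡⟨ sym (countList-∑ (admissible ∘ columns) (allVecs colours n)) ⟩
    countList (admissible ∘ columns) (allVecs colours n)
      ≡⟨ countList-cong admissible-columns (allVecs colours n) ⟩
    countList (λ C → all (λ a → descending (lookup C a) ∧ ⌊ lookup C a ≟ᶜ lookup C (rep a) ⌋) (allFin n))
              (allVecs colours n)
      ≡⟨ count-colourings-constant-along rep rep-≤ ⟩
    countList descending colours ^ countList (λ a → ⌊ rep a ≟ᶠ a ⌋) (allFin n)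
      ≡⟨ cong₂ _^_ (count-descending u) (sym cc≡#fixed-rep) ⟩
    suc u ^ cc s R r2 μ ∎
    where
    open ≡-Reasoning
    colours : List (Vec Bool u)
    colours = allVecs bools u
    open Colourings _≟ᶜ_ colours (allVecs-enumerates Bool._≟_ bools-enumerates u) descending

corollary3p9 : ∀ {c ℓ} (Rg : CommutativeRing c ℓ) (s : Sig) (R : Pred s) (r2 : arity s R ≡ 2)
                 (n : ℕ) (Ψ : Sentence s n) (w w̄ : Pred s → CommutativeRing.Carrier Rg) →
                 SymmetricInModels s R r2 n Ψ →
                 (u : ℕ) → 1 ℕ.≤ u → (v : CommutativeRing.Carrier Rg) →
                 CommutativeRing._≈_ Rg
                   (extWeakConnPoly Rg s R r2 n Ψ w w̄ u v)
                   (sumOverModels Rg s n Ψ (λ μ →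
                      CommutativeRing._*_ Rg
                        (CommutativeRing._*_ Rg (weight Rg s μ w w̄)
                          (pow Rg (fromℕ Rg (suc u)) (cc s R r2 μ)))
                        (pow Rg v (twoE s R μ))))
corollary3p9 Rg s R r2 n Ψ w w̄ _ u _ v = begin
  extWeakConnPoly Rg s R r2 n Ψ w w̄ u v
    ≈⟨ sumOverModels-extension (PsiRu s R r2 u Ψ) Ψ admissible (λ A μ → models-PsiRu μ A Ψ) _ _
                               (λ A μ → weight-extension s R A μ w w̄ v) ⟩
  sumOverModels Rg s n Ψ (λ μ → fromℕ Rg (#admissible μ) *ᴿ (W μ *ᴿ pow Rg v (twoE s R μ)))
    ≈⟨ sumOverModels-cong Ψ (λ μ → ≈-trans (*-cong (multiplicity μ) ≈-refl) (x∙yz≈yx∙z _ _ _)) ⟩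
  sumOverModels Rg s n Ψ (λ μ → (W μ *ᴿ pow Rg (fromℕ Rg (suc u)) (cc s R r2 μ)) *ᴿ pow Rg v (twoE s R μ)) ∎
  where
  open CommutativeRing Rg using (*-cong; *-commutativeSemigroup; setoid)
    renaming (_*_ to _*ᴿ_; refl to ≈-refl; trans to ≈-trans; reflexive to ≈-reflexive)
  open import Algebra.Properties.CommutativeSemigroup *-commutativeSemigroup using (x∙yz≈yx∙z)
  open import Relation.Binary.Reasoning.Setoid setoid
  open Weighted Rg
  open Extension u s R r2 using (admissible; models-PsiRu; count-admissible)
  W : World n s → CommutativeRing.Carrier Rg
  W μ = weight Rg s μ w w̄
  #admissible : World n s → ℕ
  #admissible μ = countList (admissible μ) (allWorlds n (preds u 1))
  multiplicity : ∀ μ → CommutativeRing._≈_ Rg (fromℕ Rg (#admissible μ)) (pow Rg (fromℕ Rg (suc u)) (cc s R r2 μ))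
  multiplicity μ = ≈-trans (≈-reflexive (cong (fromℕ Rg) (count-admissible μ))) (fromℕ-^ (suc u) (cc s R r2 μ))
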